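{- The set of Sprugnoli arrays of the form $(1,f_1,x)$ (with $f_1\in\mathcal{F}_1$) is a subgroup of the Sprugnoli group.
   Context: All power series are formal power series over a field $\mathbb{K}$ of characteristic $0$. $\mathcal{F}_r$ denotes the set of power series $\sum_{n\ge r}a_nx^n$ with $a_r\ne0$. A Sprugnoli array is a triple $(g,f_1,f_2)$ with $g\in\mathcal{F}_0$, $f_1\in\mathcal{F}_1$, $f_2\in\mathcal{F}_1$ and $f_2$ odd (only odd powers of $x$); its matrix is the lower-triangular matrix $(t_{n,k})$ with $t_{n,k}=[x^n]\,g(x)f_1(x)^{k\bmod 2}(xf_2(x))^{\lfloor k/2\rfloor}$. For $h=\sum_n a_nx^n$, $(g,f_1,f_2)\cdot h=\sum_n(\sum_k t_{n,k}a_k)x^n$. The Sprugnoli group is the set of Sprugnoli arrays with the product $S\cdot(u,v_1,v_2)=\left(S\cdot u,\frac{S\cdot(uv_1)}{S\cdot u},\frac1x\frac{S\cdot(xuv_2)}{S\cdot u}\right)$ for $S=(g,f_1,f_2)$, and identity $(1,x,x)$; this product corresponds to multiplication of the associated matrices. -}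

module Defs where

open import Level using (Level; _⊔_) renaming (suc to lsuc)
open import Algebra.Bundles using (CommutativeRing)
open import Data.Nat using (ℕ; zero; suc; _∸_; _≟_)
open import Data.Nat.DivMod using (_%_; _/_)
open import Data.Product using (_×_)
open import Relation.Nullary using (¬_; yes; no)

-- A field: a commutative ring with 0 ≠ 1 and inverses of nonzero elements.
-- (_⁻¹ is a total operation; its value at 0 is irrelevant.)
record Field (c ℓ : Level) : Set (lsuc (c ⊔ ℓ)) where
  field
    commutativeRing : CommutativeRing c ℓ
  open CommutativeRing commutativeRing public
  infix 8 _⁻¹
  field
    _⁻¹       : Carrier → Carrier
    ⁻¹-inverse : ∀ x → ¬ (x ≈ 0#) → (x * x ⁻¹) ≈ 1#
    0≉1       : ¬ (0# ≈ 1#)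

module _ {c ℓ : Level} (K : Field c ℓ) where
  open Field K hiding (zero)

  natCast : ℕ → Carrier
  natCast zero    = 0#
  natCast (suc n) = 1# + natCast n

  CharZero : Set ℓ
  CharZero = ∀ n → ¬ (natCast (suc n) ≈ 0#)

module Sprugnoli {c ℓ : Level} (K : Field c ℓ) where
  open Field K hiding (zero)

  PS : Set c
  PS = ℕ → Carrier

  _≋_ : PS → PS → Set ℓ
  a ≋ b = ∀ n → a n ≈ b n

  sumTo : (ℕ → Carrier) → ℕ → Carrier
  sumTo f zero    = f zero
  sumTo f (suc n) = sumTo f n + f (suc n)

  one : PS
  one zero    = 1#
  one (suc _) = 0#

  X : PS
  X zero          = 0#
  X (suc zero)    = 1#
  X (suc (suc _)) = 0#

  mul : PS → PS → PS
  mul a b n = sumTo (λ k → a k * b (n ∸ k)) n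

  pow : PS → ℕ → PS
  pow a zero    = one
  pow a (suc m) = mul a (pow a m)

  xMul : PS → PS
  xMul a zero    = 0#
  xMul a (suc n) = a n

  divX : PS → PS
  divX a n = a (suc n)

  -- multiplicative inverse of a series with invertible constant term:
  -- b 0 = a0⁻¹,  b n = - a0⁻¹ * Σ_{k=1}^{n} a k * b (n-k)   (n ≥ 1).
  -- invUpTo a n agrees with the inverse on all indices ≤ n.
  invUpTo : PS → ℕ → PS
  invUpTo a zero    = λ _ → a zero ⁻¹
  invUpTo a (suc n) m with m ≟ suc n
  ... | yes _ = - (a zero ⁻¹ * sumTo (λ k → a (suc k) * invUpTo a n (n ∸ k)) n)
  ... | no  _ = invUpTo a n m

  inv : PS → PS
  inv a n = invUpTo a n n

  div : PS → PS → PS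
  div a b = mul a (inv b)

  InF0 : PS → Set ℓ
  InF0 a = ¬ (a zero ≈ 0#)

  InF1 : PS → Set ℓ
  InF1 a = (a zero ≈ 0#) × ¬ (a 1 ≈ 0#)

  Odd : PS → Set ℓ
  Odd a = ∀ n → a (2 Data.Nat.* n) ≈ 0#

  record Triple : Set c where
    constructor ⟨_,_,_⟩
    field
      g f₁ f₂ : PS
  open Triple public

  IsSprugnoli : Triple → Set ℓ
  IsSprugnoli T = InF0 (g T) × InF1 (f₁ T) × InF1 (f₂ T) × Odd (f₂ T)

  _≈T_ : Triple → Triple → Set ℓ
  S ≈T T = (g S ≋ g T) × (f₁ S ≋ f₁ T) × (f₂ S ≋ f₂ T)

  column : Triple → ℕ → PS
  column S k = mul (g S) (mul (pow (f₁ S) (k % 2)) (pow (xMul (f₂ S)) (k / 2)))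

  entry : Triple → ℕ → ℕ → Carrier
  entry S n k = column S k n

  -- S · h : n-th coefficient Σ_{k ≤ n} t_{n,k} a_k (the matrix is lower triangular)
  act : Triple → PS → PS
  act S h n = sumTo (λ k → entry S n k * h k) n

  _⋆_ : Triple → Triple → Triple
  S ⋆ ⟨ u , v₁ , v₂ ⟩ =
    ⟨ act S u
    , div (act S (mul u v₁)) (act S u)
    , divX (div (act S (xMul (mul u v₂))) (act S u)) ⟩

  identity : Triple
  identity = ⟨ one , X , X ⟩

  InH : Triple → Set ℓ
  InH T = (g T ≋ one) × InF1 (f₁ T) × (f₂ T ≋ X)

-- For S = (1 , f , x) the k-th column of the matrix is x^k for even k and f·x^(k-1)
-- for odd k, so S acts on a series h = e + o (even and odd parts) by
-- h ↦ e + f·(o/x).  Hence (1 , f , x) ⋆ (1 , v , x) = (1 , e_v + f·(o_v/x) , x),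
-- which is again of the same form.  Writing f = e + x·p with p even and p(0) ≠ 0,
-- the array (1 , (x - e)·p⁻¹ , x) is a two-sided inverse of (1 , f , x).
module Submission where

open import Defs
open import Level using (Level)
open import Data.Bool using (Bool; true; false; if_then_else_; not; _xor_)
open import Data.Bool.Properties using (not-¬; ¬-not) renaming (_≟_ to _≟ᵇ_)
open import Data.Empty using (⊥-elim)
import Data.Nat as ℕ
open ℕ using (ℕ; zero; suc; _∸_; _≤_; z≤n; s≤s; _≟_)
open import Data.Nat.DivMod using (_%_; _/_; m/n≡1+[m∸n]/n)
open import Data.Nat.Properties
  using ( m≤n⇒m<n∨m≡n; m≤n⇒m≤1+n; ≤-refl; <-irrefl; m∸[m∸n]≡n; m+[n∸m]≡n
        ; n∸n≡0; m∸n≤m; even≢odd )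
open import Data.Product using (_×_; _,_; proj₁; proj₂; Σ)
open import Data.Sum using (inj₁; inj₂)
open import Relation.Nullary using (¬_; yes; no)
open import Relation.Binary.PropositionalEquality as ≡ using (_≡_; _≢_)

module _ {c ℓ : Level} (K : Field c ℓ) where
  open Field K hiding (zero)
  open Sprugnoli K
  open import Relation.Binary.Reasoning.Setoid setoid
  open import Algebra.Properties.Ring ring using (-‿distribʳ-*; -0#≈0#)
  open import Algebra.Properties.CommutativeSemigroup +-commutativeSemigroup using (interchange)
  open import Algebra.Properties.AbelianGroup +-abelianGroup using (⁻¹-∙-comm)

  sumTo-cong : ∀ {f h} n → (∀ k → k ≤ n → f k ≈ h k) → sumTo f n ≈ sumTo h n
  sumTo-cong zero    f≈h = f≈h 0 z≤n
  sumTo-cong (suc n) f≈h = +-cong (sumTo-cong n (λ k k≤n → f≈h k (m≤n⇒m≤1+n k≤n))) (f≈h (suc n) ≤-refl)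

  sumTo-zero : ∀ {f} n → (∀ k → k ≤ n → f k ≈ 0#) → sumTo f n ≈ 0#
  sumTo-zero zero    f≈0 = f≈0 0 z≤n
  sumTo-zero (suc n) f≈0 =
    trans (+-cong (sumTo-zero n (λ k k≤n → f≈0 k (m≤n⇒m≤1+n k≤n))) (f≈0 (suc n) ≤-refl)) (+-identityʳ 0#)

  sumTo-+ : ∀ f h n → sumTo (λ k → f k + h k) n ≈ sumTo f n + sumTo h n
  sumTo-+ f h zero    = refl
  sumTo-+ f h (suc n) = trans (+-congʳ (sumTo-+ f h n)) (interchange _ _ _ _)

  sumTo-*ˡ : ∀ a f n → sumTo (λ k → a * f k) n ≈ a * sumTo f n
  sumTo-*ˡ a f zero    = refl
  sumTo-*ˡ a f (suc n) = trans (+-congʳ (sumTo-*ˡ a f n)) (sym (distribˡ a (sumTo f n) (f (suc n))))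

  sumTo-neg : ∀ f n → sumTo (λ k → - f k) n ≈ - sumTo f n
  sumTo-neg f zero    = refl
  sumTo-neg f (suc n) = trans (+-congʳ (sumTo-neg f n)) (⁻¹-∙-comm _ _)

  sumTo-suc : ∀ f n → sumTo f (suc n) ≈ f 0 + sumTo (λ k → f (suc k)) n
  sumTo-suc f zero    = refl
  sumTo-suc f (suc n) = trans (+-congʳ (sumTo-suc f n)) (+-assoc _ _ _)

  sumTo-single : ∀ {f} n j → j ≤ n → (∀ k → k ≤ n → k ≢ j → f k ≈ 0#) → sumTo f n ≈ f j
  sumTo-single zero    zero z≤n _    = refl
  sumTo-single (suc n) j    j≤n f≈0 with m≤n⇒m<n∨m≡n j≤n
  ... | inj₁ (s≤s j≤n′) =
    trans (+-cong (sumTo-single n j j≤n′ (λ k k≤n → f≈0 k (m≤n⇒m≤1+n k≤n)))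
                  (f≈0 (suc n) ≤-refl (λ n≡j → <-irrefl (≡.sym n≡j) (s≤s j≤n′))))
          (+-identityʳ _)
  ... | inj₂ ≡.refl =
    trans (+-congʳ (sumTo-zero n (λ k k≤n → f≈0 k (m≤n⇒m≤1+n k≤n) (λ k≡n → <-irrefl k≡n (s≤s k≤n)))))
          (+-identityˡ _)

  sumTo-reverse : ∀ f n → sumTo f n ≈ sumTo (λ k → f (n ∸ k)) n
  sumTo-reverse f zero    = refl
  sumTo-reverse f (suc n) = begin
    sumTo f n + f (suc n)                  ≈⟨ +-congʳ (sumTo-reverse f n) ⟩
    sumTo (λ k → f (n ∸ k)) n + f (suc n)  ≈⟨ +-comm _ _ ⟩
    f (suc n) + sumTo (λ k → f (n ∸ k)) n  ≈⟨ sumTo-suc (λ k → f (suc n ∸ k)) n ⟨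
    sumTo (λ k → f (suc n ∸ k)) (suc n)    ∎

  add : PS → PS → PS
  add a b n = a n + b n

  neg : PS → PS
  neg a n = - a n

  scale : Carrier → PS → PS
  scale x a n = x * a n

  zeroPS : PS
  zeroPS _ = 0#

  ≋-refl : ∀ {a} → a ≋ a
  ≋-refl n = refl

  ≋-sym : ∀ {a b} → a ≋ b → b ≋ a
  ≋-sym a≋b n = sym (a≋b n)

  ≋-trans : ∀ {a b d} → a ≋ b → b ≋ d → a ≋ d
  ≋-trans a≋b b≋d n = trans (a≋b n) (b≋d n)

  xMul-cong : ∀ {a b} → a ≋ b → xMul a ≋ xMul b
  xMul-cong a≋b zero    = refl
  xMul-cong a≋b (suc n) = a≋b n

  divX-cong : ∀ {a b} → a ≋ b → divX a ≋ divX b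
  divX-cong a≋b n = a≋b (suc n)

  mul-congˡ : ∀ {a a′} b → a ≋ a′ → mul a b ≋ mul a′ b
  mul-congˡ b a≋a′ n = sumTo-cong n (λ k _ → *-congʳ (a≋a′ k))

  mul-congʳ : ∀ a {b b′} → b ≋ b′ → mul a b ≋ mul a b′
  mul-congʳ a b≋b′ n = sumTo-cong n (λ k _ → *-congˡ (b≋b′ (n ∸ k)))

  mul-comm : ∀ a b → mul a b ≋ mul b a
  mul-comm a b n = begin
    sumTo (λ k → a k * b (n ∸ k)) n                 ≈⟨ sumTo-reverse _ n ⟩
    sumTo (λ k → a (n ∸ k) * b (n ∸ (n ∸ k))) n     ≈⟨ sumTo-cong n (λ k _ → *-comm _ _) ⟩
    sumTo (λ k → b (n ∸ (n ∸ k)) * a (n ∸ k)) n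
      ≈⟨ sumTo-cong n (λ k k≤n → reflexive (≡.cong (λ i → b i * a (n ∸ k)) (m∸[m∸n]≡n k≤n))) ⟩
    sumTo (λ k → b k * a (n ∸ k)) n                 ∎

  mul-identityˡ : ∀ a → mul one a ≋ a
  mul-identityˡ a n = trans (sumTo-single n 0 z≤n one-off) (*-identityˡ _)
    where
    one-off : ∀ k → k ≤ n → k ≢ 0 → one k * a (n ∸ k) ≈ 0#
    one-off zero    _ k≢0 = ⊥-elim (k≢0 ≡.refl)
    one-off (suc k) _ _   = zeroˡ _

  mul-identityʳ : ∀ a → mul a one ≋ a
  mul-identityʳ a = ≋-trans (mul-comm a one) (mul-identityˡ a)

  mul-zeroˡ : ∀ {a} b → a ≋ zeroPS → mul a b ≋ zeroPS
  mul-zeroˡ b a≋0 n = sumTo-zero n (λ k _ → trans (*-congʳ (a≋0 k)) (zeroˡ _))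

  mul-distribʳ : ∀ a b d → mul (add a b) d ≋ add (mul a d) (mul b d)
  mul-distribʳ a b d n = trans (sumTo-cong n (λ k _ → distribʳ _ _ _)) (sumTo-+ _ _ n)

  mul-distribˡ : ∀ d a b → mul d (add a b) ≋ add (mul d a) (mul d b)
  mul-distribˡ d a b n = trans (sumTo-cong n (λ k _ → distribˡ _ _ _)) (sumTo-+ _ _ n)

  mul-scaleˡ : ∀ x a b → mul (scale x a) b ≋ scale x (mul a b)
  mul-scaleˡ x a b n = trans (sumTo-cong n (λ k _ → *-assoc _ _ _)) (sumTo-*ˡ x _ n)

  mul-negʳ : ∀ a b → mul a (neg b) ≋ neg (mul a b)
  mul-negʳ a b n = trans (sumTo-cong n (λ k _ → sym (-‿distribʳ-* _ _))) (sumTo-neg _ n)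

  mul-xMulˡ : ∀ a b → mul (xMul a) b ≋ xMul (mul a b)
  mul-xMulˡ a b zero    = zeroˡ _
  mul-xMulˡ a b (suc n) = trans (sumTo-suc _ n) (trans (+-congʳ (zeroˡ _)) (+-identityˡ _))

  mul-xMulʳ : ∀ a b → mul a (xMul b) ≋ xMul (mul a b)
  mul-xMulʳ a b = ≋-trans (mul-comm a _) (≋-trans (mul-xMulˡ b a) (xMul-cong (mul-comm b a)))

  mul-unfoldˡ : ∀ a b → mul a b ≋ add (scale (a 0) b) (xMul (mul (divX a) b))
  mul-unfoldˡ a b zero    = sym (+-identityʳ _)
  mul-unfoldˡ a b (suc n) = sumTo-suc _ n

  mul-assoc : ∀ a b d → mul (mul a b) d ≋ mul a (mul b d)
  mul-assoc a b d n = begin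
    mul (mul a b) d n                                              ≈⟨ mul-congˡ d (mul-unfoldˡ a b) n ⟩
    mul (add (scale (a 0) b) (xMul (mul (divX a) b))) d n          ≈⟨ mul-distribʳ _ _ d n ⟩
    mul (scale (a 0) b) d n + mul (xMul (mul (divX a) b)) d n
      ≈⟨ +-cong (mul-scaleˡ (a 0) b d n) (mul-xMulˡ (mul (divX a) b) d n) ⟩
    a 0 * mul b d n + xMul (mul (mul (divX a) b) d) n              ≈⟨ +-congˡ (shifted n) ⟩
    a 0 * mul b d n + xMul (mul (divX a) (mul b d)) n              ≈⟨ mul-unfoldˡ a (mul b d) n ⟨
    mul a (mul b d) n                                              ∎
    where
    shifted : ∀ n → xMul (mul (mul (divX a) b) d) n ≈ xMul (mul (divX a) (mul b d)) n
    shifted zero    = refl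
    shifted (suc m) = mul-assoc (divX a) b d m

  invUpTo-top : ∀ a n → invUpTo a (suc n) (suc n) ≡ - (a 0 ⁻¹ * sumTo (λ k → a (suc k) * invUpTo a n (n ∸ k)) n)
  invUpTo-top a n with suc n ≟ suc n
  ... | yes _   = ≡.refl
  ... | no  n≢n = ⊥-elim (n≢n ≡.refl)

  invUpTo-stable : ∀ a n m → m ≤ n → invUpTo a n m ≡ inv a m
  invUpTo-stable a zero    .zero z≤n = ≡.refl
  invUpTo-stable a (suc n) m     m≤n with m≤n⇒m<n∨m≡n m≤n
  ... | inj₂ ≡.refl = ≡.refl
  ... | inj₁ (s≤s m≤n′) with m ≟ suc n
  ...   | yes m≡n = ⊥-elim (<-irrefl m≡n (s≤s m≤n′))
  ...   | no  _   = invUpTo-stable a n m m≤n′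

  mul-inverseʳ : ∀ a → InF0 a → mul a (inv a) ≋ one
  mul-inverseʳ a a0≉0 zero    = ⁻¹-inverse (a 0) a0≉0
  mul-inverseʳ a a0≉0 (suc n) = begin
    mul a (inv a) (suc n)                ≈⟨ sumTo-suc _ n ⟩
    a 0 * inv a (suc n) + s              ≈⟨ +-congʳ (*-congˡ (reflexive (invUpTo-top a n))) ⟩
    a 0 * - (a 0 ⁻¹ * s′) + s            ≈⟨ +-congʳ (*-congˡ (-‿cong (*-congˡ s′≈s))) ⟩
    a 0 * - (a 0 ⁻¹ * s) + s             ≈⟨ +-congʳ (-‿distribʳ-* _ _) ⟨
    - (a 0 * (a 0 ⁻¹ * s)) + s           ≈⟨ +-congʳ (-‿cong (*-assoc _ _ _)) ⟨
    - ((a 0 * a 0 ⁻¹) * s) + s           ≈⟨ +-congʳ (-‿cong (*-congʳ (⁻¹-inverse (a 0) a0≉0))) ⟩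
    - (1# * s) + s                       ≈⟨ +-congʳ (-‿cong (*-identityˡ s)) ⟩
    - s + s                              ≈⟨ -‿inverseˡ s ⟩
    0#                                   ∎
    where
    s s′ : Carrier
    s  = sumTo (λ k → a (suc k) * inv a (n ∸ k)) n
    s′ = sumTo (λ k → a (suc k) * invUpTo a n (n ∸ k)) n
    s′≈s : s′ ≈ s
    s′≈s = sumTo-cong n (λ k _ → *-congˡ (reflexive (invUpTo-stable a n (n ∸ k) (m∸n≤m n k))))

  inv-one : ∀ {a} → a ≋ one → inv a ≋ one
  inv-one {a} a≋1 =
    ≋-trans (≋-sym (mul-identityˡ (inv a))) (≋-trans (mul-congˡ (inv a) (≋-sym a≋1)) (mul-inverseʳ a a0≉0))
    where
    a0≉0 : InF0 a
    a0≉0 a0≈0 = 0≉1 (trans (sym a0≈0) (a≋1 0))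

  div-one : ∀ a {b} → b ≋ one → div a b ≋ a
  div-one a b≋1 = ≋-trans (mul-congʳ a (inv-one b≋1)) (mul-identityʳ a)

  -- Even and odd parts

  isOdd : ℕ → Bool
  isOdd zero          = false
  isOdd (suc zero)    = true
  isOdd (suc (suc n)) = isOdd n

  isOdd-suc : ∀ n → isOdd (suc n) ≡ not (isOdd n)
  isOdd-suc zero          = ≡.refl
  isOdd-suc (suc zero)    = ≡.refl
  isOdd-suc (suc (suc n)) = isOdd-suc n

  isOdd-+ : ∀ k m → isOdd (k ℕ.+ m) ≡ isOdd k xor isOdd m
  isOdd-+ zero          m = ≡.refl
  isOdd-+ (suc zero)    m = isOdd-suc m
  isOdd-+ (suc (suc k)) m = isOdd-+ k m

  evenPart oddPart : PS → PS
  evenPart a n = if isOdd n then 0# else a n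
  oddPart  a n = if isOdd n then a n else 0#

  -- HasParity false a: a is an even series; HasParity true a: an odd one.
  HasParity : Bool → PS → Set ℓ
  HasParity α a = ∀ n → isOdd n ≢ α → a n ≈ 0#

  mul-parity : ∀ {α β a b} → HasParity α a → HasParity β b → HasParity (α xor β) (mul a b)
  mul-parity {α} {β} {a} {b} a∈α b∈β n n∉αβ = sumTo-zero n term≈0
    where
    term≈0 : ∀ k → k ≤ n → a k * b (n ∸ k) ≈ 0#
    term≈0 k k≤n with isOdd k ≟ᵇ α | isOdd (n ∸ k) ≟ᵇ β
    ... | no k∉α  | _          = trans (*-congʳ (a∈α k k∉α)) (zeroˡ _)
    ... | yes _   | no  n-k∉β  = trans (*-congˡ (b∈β (n ∸ k) n-k∉β)) (zeroʳ _)
    ... | yes k∈α | yes n-k∈β  = ⊥-elim (n∉αβ (≡.trans (≡.cong isOdd (≡.sym (m+[n∸m]≡n k≤n)))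
                                    (≡.trans (isOdd-+ k (n ∸ k)) (≡.cong₂ _xor_ k∈α n-k∈β))))

  neg-parity : ∀ {α a} → HasParity α a → HasParity α (neg a)
  neg-parity a∈α n n∉α = trans (-‿cong (a∈α n n∉α)) -0#≈0#

  evenPart-even : ∀ a → HasParity false (evenPart a)
  evenPart-even a n n-odd with isOdd n
  ... | true  = refl
  ... | false = ⊥-elim (n-odd ≡.refl)

  oddPart-odd : ∀ a → HasParity true (oddPart a)
  oddPart-odd a n n-even with isOdd n
  ... | true  = ⊥-elim (n-even ≡.refl)
  ... | false = refl

  evenPart-cong : ∀ {a b} → a ≋ b → evenPart a ≋ evenPart b
  evenPart-cong a≋b n with isOdd n
  ... | true  = refl
  ... | false = a≋b n

  ≋-evenPart+oddPart : ∀ a → a ≋ add (evenPart a) (oddPart a)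
  ≋-evenPart+oddPart a n with isOdd n
  ... | true  = sym (+-identityˡ _)
  ... | false = sym (+-identityʳ _)

  evenPart-of-even : ∀ {a} → HasParity false a → evenPart a ≋ a
  evenPart-of-even a-even n with isOdd n in n-parity
  ... | true  = sym (a-even n (not-¬ n-parity))
  ... | false = refl

  oddPart-of-even : ∀ {a} → HasParity false a → oddPart a ≋ zeroPS
  oddPart-of-even a-even n with isOdd n in n-parity
  ... | true  = a-even n (not-¬ n-parity)
  ... | false = refl

  evenPart-add-even-odd : ∀ {u v} → HasParity false u → HasParity true v → evenPart (add u v) ≋ u
  evenPart-add-even-odd u-even v-odd n with isOdd n in n-parity
  ... | true  = sym (u-even n (not-¬ n-parity))
  ... | false = trans (+-congˡ (v-odd n (not-¬ n-parity))) (+-identityʳ _)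

  oddPart-add-even-odd : ∀ {u v} → HasParity false u → HasParity true v → oddPart (add u v) ≋ v
  oddPart-add-even-odd u-even v-odd n with isOdd n in n-parity
  ... | true  = trans (+-congʳ (u-even n (not-¬ n-parity))) (+-identityˡ _)
  ... | false = sym (v-odd n (not-¬ n-parity))

  one-even : HasParity false one
  one-even zero    0-odd = ⊥-elim (0-odd ≡.refl)
  one-even (suc n) _     = refl

  X-off : ∀ k → k ≢ 1 → X k ≈ 0#
  X-off zero          _   = refl
  X-off (suc zero)    k≢1 = ⊥-elim (k≢1 ≡.refl)
  X-off (suc (suc k)) _   = refl

  X-odd : HasParity true X
  X-odd k k-even = X-off k (λ { ≡.refl → k-even ≡.refl })

  -- The action of (1 , f , x)

  monomial : ℕ → PS
  monomial zero    = one
  monomial (suc j) = xMul (monomial j)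

  monomial-diag : ∀ n → monomial n n ≡ 1#
  monomial-diag zero    = ≡.refl
  monomial-diag (suc n) = monomial-diag n

  monomial-off : ∀ k n → k ≢ n → monomial k n ≡ 0#
  monomial-off zero    zero    k≢n = ⊥-elim (k≢n ≡.refl)
  monomial-off zero    (suc n) _   = ≡.refl
  monomial-off (suc k) zero    _   = ≡.refl
  monomial-off (suc k) (suc n) k≢n = monomial-off k n (λ k≡n → k≢n (≡.cong suc k≡n))

  X≋monomial1 : X ≋ monomial 1
  X≋monomial1 zero          = refl
  X≋monomial1 (suc zero)    = refl
  X≋monomial1 (suc (suc n)) = refl

  mul-monomial2 : ∀ a → mul (monomial 2) a ≋ xMul (xMul a)
  mul-monomial2 a =
    ≋-trans (mul-xMulˡ (monomial 1) a) (xMul-cong (≋-trans (mul-xMulˡ one a) (xMul-cong (mul-identityˡ a))))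

  monomial2-even : HasParity false (monomial 2)
  monomial2-even zero          0-odd = ⊥-elim (0-odd ≡.refl)
  monomial2-even (suc zero)    _     = refl
  monomial2-even (suc (suc n)) n-odd = one-even n n-odd

  act1fx : PS → PS → PS
  act1fx f h = add (evenPart h) (mul (divX (oddPart h)) f)

  splitByParity : ∀ b (u m w : Carrier) →
    (if b then u else m) * w ≈ m * (if b then 0# else w) + (if b then w else 0#) * u
  splitByParity true  u m w = trans (*-comm u w) (sym (trans (+-congʳ (zeroʳ m)) (+-identityˡ _)))
  splitByParity false u m w = sym (trans (+-congˡ (zeroˡ u)) (+-identityʳ _))

  module ActionOf1fx (S : Triple) (g≋one : g S ≋ one) (f₂≋X : f₂ S ≋ X) (f₁0≈0 : f₁ S 0 ≈ 0#) where
    private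
      f : PS
      f = f₁ S

      xf₂≋monomial2 : xMul (f₂ S) ≋ monomial 2
      xf₂≋monomial2 = xMul-cong (≋-trans f₂≋X X≋monomial1)

    column-suc-suc : ∀ k → column S (suc (suc k)) ≋ xMul (xMul (column S k))
    column-suc-suc k n = begin
      mul (g S) (mul P (pow xf₂ (suc (suc k) / 2))) n  ≈⟨ mul-congʳ (g S) (mul-congʳ P pow-step) n ⟩
      mul (g S) (mul P (mul xf₂ Q)) n                   ≈⟨ mul-congʳ (g S) reorder n ⟩
      mul (g S) (mul xf₂ (mul P Q)) n
        ≈⟨ mul-congʳ (g S) (≋-trans (mul-congˡ (mul P Q) xf₂≋monomial2) (mul-monomial2 (mul P Q))) n ⟩
      mul (g S) (xMul (xMul (mul P Q))) n
        ≈⟨ ≋-trans (mul-xMulʳ (g S) (xMul (mul P Q))) (xMul-cong (mul-xMulʳ (g S) (mul P Q))) n ⟩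
      xMul (xMul (mul (g S) (mul P Q))) n               ∎
      where
      xf₂ P Q : PS
      xf₂ = xMul (f₂ S)
      P   = pow f (k % 2)
      Q   = pow xf₂ (k / 2)
      pow-step : pow xf₂ (suc (suc k) / 2) ≋ mul xf₂ Q
      pow-step n = reflexive (≡.cong (λ i → pow xf₂ i n) (m/n≡1+[m∸n]/n {suc (suc k)} {2} (s≤s (s≤s z≤n))))
      reorder : mul P (mul xf₂ Q) ≋ mul xf₂ (mul P Q)
      reorder = ≋-trans (≋-sym (mul-assoc P xf₂ Q)) (≋-trans (mul-congˡ Q (mul-comm P xf₂)) (mul-assoc xf₂ P Q))

    entry-lower : ∀ k n → k ≤ n → entry S n k ≈ (if isOdd k then f (suc n ∸ k) else monomial k n)
    entry-lower zero          n _ =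
      ≋-trans (mul-congˡ (mul one one) g≋one) (≋-trans (mul-identityˡ _) (mul-identityˡ one)) n
    entry-lower (suc zero)    n _ =
      ≋-trans (mul-congˡ (mul (mul f one) one) g≋one)
              (≋-trans (mul-identityˡ _) (≋-trans (mul-identityʳ _) (mul-identityʳ f))) n
    entry-lower (suc (suc k)) (suc (suc n)) (s≤s (s≤s k≤n)) =
      trans (column-suc-suc k (suc (suc n))) (entry-lower k n k≤n)

    act≋act1fx : ∀ h → act S h ≋ act1fx f h
    act≋act1fx h n = begin
      act S h n
        ≈⟨ sumTo-cong n (λ k k≤n → *-congʳ (entry-lower k n k≤n)) ⟩
      sumTo (λ k → (if isOdd k then f (suc n ∸ k) else monomial k n) * h k) n
        ≈⟨ sumTo-cong n (λ k _ → splitByParity (isOdd k) (f (suc n ∸ k)) (monomial k n) (h k)) ⟩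
      sumTo (λ k → monomial k n * evenPart h k + G k) n     ≈⟨ sumTo-+ _ G n ⟩
      sumTo (λ k → monomial k n * evenPart h k) n + sumTo G n ≈⟨ +-cong even-sum odd-sum ⟩
      evenPart h n + mul (divX (oddPart h)) f n             ∎
      where
      G : ℕ → Carrier
      G k = oddPart h k * f (suc n ∸ k)
      even-sum : sumTo (λ k → monomial k n * evenPart h k) n ≈ evenPart h n
      even-sum =
        trans (sumTo-single n n ≤-refl (λ k _ k≢n → trans (*-congʳ (reflexive (monomial-off k n k≢n))) (zeroˡ _)))
              (trans (*-congʳ (reflexive (monomial-diag n))) (*-identityˡ _))
      last-term≈0 : G (suc n) ≈ 0#
      last-term≈0 = trans (*-congˡ (trans (reflexive (≡.cong f (n∸n≡0 n))) f₁0≈0)) (zeroʳ _)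
      odd-sum : sumTo G n ≈ mul (divX (oddPart h)) f n
      odd-sum = begin
        sumTo G n                                 ≈⟨ +-identityʳ _ ⟨
        sumTo G n + 0#                            ≈⟨ +-congˡ last-term≈0 ⟨
        sumTo G (suc n)                           ≈⟨ sumTo-suc G n ⟩
        0# * f (suc n) + mul (divX (oddPart h)) f n ≈⟨ +-congʳ (zeroˡ _) ⟩
        0# + mul (divX (oddPart h)) f n           ≈⟨ +-identityˡ _ ⟩
        mul (divX (oddPart h)) f n                ∎

  act-cong : ∀ S {h h′} → h ≋ h′ → act S h ≋ act S h′
  act-cong S h≋h′ n = sumTo-cong n (λ k _ → *-congˡ (h≋h′ k))

  act1fx-even : ∀ f {a} → HasParity false a → act1fx f a ≋ a
  act1fx-even f a-even n =
    trans (+-cong (evenPart-of-even a-even n) (mul-zeroˡ f (divX-cong (oddPart-of-even a-even)) n)) (+-identityʳ _)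

  x≉0∧y≉0⇒x*y≉0 : ∀ {x y} → ¬ (x ≈ 0#) → ¬ (y ≈ 0#) → ¬ (x * y ≈ 0#)
  x≉0∧y≉0⇒x*y≉0 {x} {y} x≉0 y≉0 xy≈0 = y≉0 (begin
    y                ≈⟨ *-identityˡ y ⟨
    1# * y           ≈⟨ *-congʳ (trans (*-comm _ _) (⁻¹-inverse x x≉0)) ⟨
    (x ⁻¹ * x) * y   ≈⟨ *-assoc _ _ _ ⟩
    x ⁻¹ * (x * y)   ≈⟨ *-congˡ xy≈0 ⟩
    x ⁻¹ * 0#        ≈⟨ zeroʳ _ ⟩
    0#               ∎)

  InF1-resp : ∀ {a b} → a ≋ b → InF1 a → InF1 b
  InF1-resp a≋b (a0≈0 , a1≉0) = trans (sym (a≋b 0)) a0≈0 , λ b1≈0 → a1≉0 (trans (a≋b 1) b1≈0)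

  act1fx-InF1 : ∀ {f v} → InF1 f → InF1 v → InF1 (act1fx f v)
  act1fx-InF1 {f} {v} (f0≈0 , f1≉0) (v0≈0 , v1≉0) = coefficient0 , coefficient1≉0
    where
    coefficient0 : act1fx f v 0 ≈ 0#
    coefficient0 = trans (+-cong v0≈0 (trans (*-congˡ f0≈0) (zeroʳ _))) (+-identityʳ 0#)
    coefficient1 : act1fx f v 1 ≈ v 1 * f 1
    coefficient1 = trans (+-identityˡ _) (trans (+-congˡ (zeroˡ _)) (+-identityʳ _))
    coefficient1≉0 : ¬ (act1fx f v 1 ≈ 0#)
    coefficient1≉0 c1≈0 = x≉0∧y≉0⇒x*y≉0 v1≉0 f1≉0 (trans (sym coefficient1) c1≈0)

  ⋆-InH : ∀ {S U} → InH S → InH U → (S ⋆ U) ≈T ⟨ one , act1fx (f₁ S) (f₁ U) , X ⟩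
  ⋆-InH {S} {U} (g≋one , (f0≈0 , _) , f₂≋X) (u≋one , _ , v₂≋X) = act-u≋one , first , second
    where
    open ActionOf1fx S g≋one f₂≋X f0≈0
    u : PS
    u = g U
    act-u≋one : act S u ≋ one
    act-u≋one = ≋-trans (act-cong S u≋one) (≋-trans (act≋act1fx one) (act1fx-even (f₁ S) one-even))
    first : div (act S (mul u (f₁ U))) (act S u) ≋ act1fx (f₁ S) (f₁ U)
    first = ≋-trans (div-one _ act-u≋one)
      (≋-trans (act-cong S (≋-trans (mul-congˡ (f₁ U) u≋one) (mul-identityˡ (f₁ U)))) (act≋act1fx (f₁ U)))
    xuv₂≋monomial2 : xMul (mul u (f₂ U)) ≋ monomial 2
    xuv₂≋monomial2 =
      xMul-cong (≋-trans (mul-congˡ (f₂ U) u≋one)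
                         (≋-trans (mul-identityˡ (f₂ U)) (≋-trans v₂≋X X≋monomial1)))
    second : divX (div (act S (xMul (mul u (f₂ U)))) (act S u)) ≋ X
    second = ≋-trans (divX-cong (div-one _ act-u≋one))
      (≋-trans (divX-cong (act-cong S xuv₂≋monomial2))
      (≋-trans (divX-cong (act≋act1fx (monomial 2)))
      (≋-trans (divX-cong (act1fx-even (f₁ S) monomial2-even)) (≋-sym X≋monomial1))))

  module InverseOf1fx (f : PS) (f∈F1 : InF1 f) where
    e p r f̄ : PS
    e = evenPart f
    p = divX (oddPart f)
    -- inv p is even like p, but taking its even part saves proving that.
    r = evenPart (inv p)
    -- With f = e + x·p, this is the series with even part -e·p⁻¹ and odd part x·p⁻¹.
    f̄ = add (neg (mul r e)) (mul r X)

    p-even : HasParity false p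
    p-even n n-odd rewrite isOdd-suc n | ¬-not n-odd = refl

    p*r≋one : mul p r ≋ one
    p*r≋one n = sym (begin
      one n                                                  ≈⟨ evenPart-of-even one-even n ⟨
      evenPart one n                                         ≈⟨ evenPart-cong (mul-inverseʳ p (proj₂ f∈F1)) n ⟨
      evenPart (mul p (inv p)) n
        ≈⟨ evenPart-cong (mul-congʳ p (≋-evenPart+oddPart (inv p))) n ⟩
      evenPart (mul p (add r (oddPart (inv p)))) n           ≈⟨ evenPart-cong (mul-distribˡ p r (oddPart (inv p))) n ⟩
      evenPart (add (mul p r) (mul p (oddPart (inv p)))) n
        ≈⟨ evenPart-add-even-odd (mul-parity p-even (evenPart-even (inv p)))
                                 (mul-parity p-even (oddPart-odd (inv p))) n ⟩
      mul p r n                                              ∎)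

    r*X≋xMul-r : mul r X ≋ xMul r
    r*X≋xMul-r = ≋-trans (mul-congʳ r X≋monomial1) (≋-trans (mul-xMulʳ r one) (xMul-cong (mul-identityʳ r)))

    oddPart-f≋xMul-p : oddPart f ≋ xMul p
    oddPart-f≋xMul-p zero    = refl
    oddPart-f≋xMul-p (suc n) = refl

    act1fx-f-f̄ : act1fx f f̄ ≋ X
    act1fx-f-f̄ n = begin
      evenPart f̄ n + mul (divX (oddPart f̄)) f n
        ≈⟨ +-cong (evenPart-add-even-odd r*e-even r*X-odd n)
                  (mul-congˡ f (divX-cong (≋-trans (oddPart-add-even-odd r*e-even r*X-odd) r*X≋xMul-r)) n) ⟩
      - mul r e n + mul r f n
        ≈⟨ +-congˡ (≋-trans (mul-congʳ r (≋-evenPart+oddPart f)) (mul-distribˡ r e (oddPart f)) n) ⟩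
      - mul r e n + (mul r e n + mul r (oddPart f) n) ≈⟨ +-assoc _ _ _ ⟨
      (- mul r e n + mul r e n) + mul r (oddPart f) n ≈⟨ +-congʳ (-‿inverseˡ _) ⟩
      0# + mul r (oddPart f) n                 ≈⟨ +-identityˡ _ ⟩
      mul r (oddPart f) n                      ≈⟨ mul-congʳ r oddPart-f≋xMul-p n ⟩
      mul r (xMul p) n                         ≈⟨ mul-xMulʳ r p n ⟩
      xMul (mul r p) n                         ≈⟨ xMul-cong (≋-trans (mul-comm r p) p*r≋one) n ⟩
      xMul one n                               ≈⟨ X≋monomial1 n ⟨
      X n                                      ∎
      where
      r*e-even : HasParity false (neg (mul r e))
      r*e-even = neg-parity (mul-parity (evenPart-even (inv p)) (evenPart-even f))
      r*X-odd : HasParity true (mul r X)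
      r*X-odd = mul-parity (evenPart-even (inv p)) X-odd

    act1fx-f̄-f : act1fx f̄ f ≋ X
    act1fx-f̄-f n = begin
      e n + mul p f̄ n
        ≈⟨ +-congˡ (mul-distribˡ p (neg (mul r e)) (mul r X) n) ⟩
      e n + (mul p (neg (mul r e)) n + mul p (mul r X) n)
        ≈⟨ +-congˡ (+-cong (mul-negʳ p (mul r e) n) (p*r*-cancel X n)) ⟩
      e n + (- mul p (mul r e) n + X n)                       ≈⟨ +-congˡ (+-congʳ (-‿cong (p*r*-cancel e n))) ⟩
      e n + (- e n + X n)                                     ≈⟨ +-assoc _ _ _ ⟨
      (e n + - e n) + X n                                     ≈⟨ +-congʳ (-‿inverseʳ _) ⟩
      0# + X n                                                ≈⟨ +-identityˡ _ ⟩
      X n                                                     ∎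
      where
      p*r*-cancel : ∀ a → mul p (mul r a) ≋ a
      p*r*-cancel a = ≋-trans (≋-sym (mul-assoc p r a)) (≋-trans (mul-congˡ a p*r≋one) (mul-identityˡ a))

    f̄∈F1 : InF1 f̄
    f̄∈F1 = f̄0≈0 , λ f̄1≈0 → r0≉0 (trans (sym f̄1≈r0) f̄1≈0)
      where
      f0≈0 : f 0 ≈ 0#
      f0≈0 = proj₁ f∈F1
      f̄0≈0 : f̄ 0 ≈ 0#
      f̄0≈0 = trans (+-cong (-‿cong (trans (*-congˡ f0≈0) (zeroʳ _))) (zeroʳ _)) (trans (+-identityʳ _) -0#≈0#)
      f̄1≈r0 : f̄ 1 ≈ r 0
      f̄1≈r0 = trans (+-cong (-‿cong r*e-1≈0) (trans (+-cong (*-identityʳ _) (zeroʳ _)) (+-identityʳ _)))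
                    (trans (+-congʳ -0#≈0#) (+-identityˡ _))
        where
        r*e-1≈0 : r 0 * 0# + r 1 * f 0 ≈ 0#
        r*e-1≈0 = trans (+-cong (zeroʳ _) (trans (*-congˡ f0≈0) (zeroʳ _))) (+-identityʳ _)
      r0≉0 : ¬ (r 0 ≈ 0#)
      r0≉0 r0≈0 = 0≉1 (trans (sym (trans (*-congˡ r0≈0) (zeroʳ _))) (p*r≋one 0))

  X∈F1 : InF1 X
  X∈F1 = refl , λ 1≈0 → 0≉1 (sym 1≈0)

  InH⇒IsSprugnoli : ∀ T → InH T → IsSprugnoli T
  InH⇒IsSprugnoli T (g≋one , f₁∈F1 , f₂≋X) =
    (λ g0≈0 → 0≉1 (trans (sym g0≈0) (g≋one 0))) ,
    f₁∈F1 ,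
    InF1-resp (≋-sym f₂≋X) X∈F1 ,
    (λ n → trans (f₂≋X (2 ℕ.* n)) (X-off (2 ℕ.* n) (even≢odd n 0)))

  InH-identity : InH identity
  InH-identity = ≋-refl , X∈F1 , ≋-refl

  InH-⋆-closed : ∀ S U → InH S → InH U → InH (S ⋆ U)
  InH-⋆-closed S U S∈H@(_ , f∈F1 , _) U∈H@(_ , v∈F1 , _) with ⋆-InH {S} {U} S∈H U∈H
  ... | g≋one , f₁≋act1fx , f₂≋X =
    g≋one ,
    InF1-resp {act1fx (f₁ S) (f₁ U)} (≋-sym f₁≋act1fx) (act1fx-InF1 {f₁ S} {f₁ U} f∈F1 v∈F1) ,
    f₂≋X

  ⋆≈identity : ∀ {S U} → InH S → InH U → act1fx (f₁ S) (f₁ U) ≋ X → (S ⋆ U) ≈T identity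
  ⋆≈identity S∈H U∈H act1fx≋X with ⋆-InH S∈H U∈H
  ... | g≋one , f₁≋act1fx , f₂≋X = g≋one , ≋-trans f₁≋act1fx act1fx≋X , f₂≋X

  InH-inverse : ∀ S → InH S → Σ Triple (λ T → InH T × ((S ⋆ T) ≈T identity) × ((T ⋆ S) ≈T identity))
  InH-inverse S S∈H = T , T∈H , ⋆≈identity S∈H T∈H act1fx-f-f̄ , ⋆≈identity T∈H S∈H act1fx-f̄-f
    where
    open InverseOf1fx (f₁ S) (proj₁ (proj₂ S∈H))
    T : Triple
    T = ⟨ one , f̄ , X ⟩
    T∈H : InH T
    T∈H = ≋-refl , f̄∈F1 , ≋-refl

mainTheorem9 : ∀ {c ℓ : Level} (K : Field c ℓ) → CharZero K →
    let open Sprugnoli K in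
    (∀ T → InH T → IsSprugnoli T)
    × InH identity
    × (∀ S U → InH S → InH U → InH (S ⋆ U))
    × (∀ S → InH S → Σ Triple (λ T → InH T × ((S ⋆ T) ≈T identity) × ((T ⋆ S) ≈T identity)))
mainTheorem9 K _ = InH⇒IsSprugnoli K , InH-identity K , InH-⋆-closed K , InH-inverse K
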